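{- Let $k\geq 5$ be an integer and $m,n$ positive integers. Then $\pi_k(\Lambda_{m,n}) = nm$.
   Context: The grid $\Lambda_{m,n}$ is the graph whose vertices are the $nm$ cells of an $m\times n$ array, two cells being adjacent iff they share a side. A pebbling distribution is a function $P:V(G)\to\mathbb{Z}_{\ge0}$ with $|P|=\sum_x P(x)$. A $k$-pebbling move removes $k$ pebbles from a vertex and adds $1$ pebble to a neighbouring vertex. A vertex $y$ is reachable (from $P$) if there is a sequence of $k$-pebbling moves starting at $P$ and ending in a distribution $Q$ with $Q(y)\ge 1$. $P$ is $k$-solvable if every vertex is reachable. The optimal $k$-pebbling number $\pi_k(G)$ is the minimum of $|P|$ over all $k$-solvable distributions $P$ on $G$. -}

module Defs where

open import Data.Nat using (ℕ; zero; suc; _+_; _∸_; _≤_)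
open import Data.Fin using (Fin; toℕ)
open import Data.Fin.Properties using () renaming (_≟_ to _≟F_)
open import Data.Product using (_×_; _,_; ∃-syntax)
open import Data.Product.Properties using (≡-dec)
open import Data.Sum using (_⊎_)
open import Relation.Binary.PropositionalEquality using (_≡_)
open import Relation.Nullary using (yes; no)

-- Cells of the m × n grid Λ_{m,n}: (row, column).
Cell : ℕ → ℕ → Set
Cell m n = Fin m × Fin n

Consec : ∀ {n} → Fin n → Fin n → Set
Consec a b = suc (toℕ a) ≡ toℕ b ⊎ suc (toℕ b) ≡ toℕ a

Adj : ∀ {m n} → Cell m n → Cell m n → Set
Adj (i , j) (i' , j') = (i ≡ i' × Consec j j') ⊎ (Consec i i' × j ≡ j')

Dist : ℕ → ℕ → Set
Dist m n = Cell m n → ℕ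

sumFin : ∀ n → (Fin n → ℕ) → ℕ
sumFin zero f = 0
sumFin (suc n) f = f Fin.zero + sumFin n (λ i → f (Fin.suc i))

size : ∀ {m n} → Dist m n → ℕ
size {m} {n} P = sumFin m (λ i → sumFin n (λ j → P (i , j)))

_≟C_ : ∀ {m n} (x y : Cell m n) → Relation.Nullary.Dec (x ≡ y)
_≟C_ = ≡-dec _≟F_ _≟F_

moveDist : ∀ {m n} → ℕ → Dist m n → Cell m n → Cell m n → Dist m n
moveDist k P x y z with z ≟C x | z ≟C y
... | yes _ | _     = P z ∸ k
... | no _  | yes _ = suc (P z)
... | no _  | no _  = P z

data Reach {m n} (k : ℕ) (P : Dist m n) : Dist m n → Set where
  done : Reach k P P
  step : ∀ {Q} x y → Reach k P Q → Adj x y → k ≤ Q x → Reach k P (moveDist k Q x y)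

Reachable : ∀ {m n} → ℕ → Dist m n → Cell m n → Set
Reachable k P y = ∃[ Q ] (Reach k P Q × 1 ≤ Q y)

Solvable : ∀ {m n} → ℕ → Dist m n → Set
Solvable k P = ∀ y → Reachable k P y

OptPebblingNumberIs : ℕ → ℕ → ℕ → ℕ → Set
OptPebblingNumberIs k m n v =
  (∃[ P ] (Solvable {m} {n} k P × size P ≡ v)) × (∀ (P : Dist m n) → Solvable k P → v ≤ size P)

-- One pebble on every cell is k-solvable. Conversely, while some cell x of a solvable
-- distribution holds at least k pebbles, fire it: remove k - 1 ≥ 4 pebbles from x and put one
-- on each neighbour. This does not increase the size, and the result is still solvable, since
-- any play from the old distribution can be replayed, its first move out of x being already
-- paid for. Firing strictly decreases the potential Σ (i+1)(m-i) P(i,j) because the row weight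
-- is strictly concave, so the process stops at a distribution with fewer than k pebbles on
-- every cell. No move is possible there, so solvability puts a pebble on each of the nm cells.
module Submission where

open import Defs
open import Data.Nat using (ℕ; _*_; _≤_; zero; suc; _+_; _∸_; _<_; _<?_; _≤?_; z≤n; s≤s; pred)
open import Data.Nat.Properties
open import Data.Nat.Induction using (<-wellFounded)
open import Data.Nat.ListAction using (sum)
open import Data.Nat.ListAction.Properties using (sum-++)
open import Data.Nat.Tactic.RingSolver using (solve-∀)
open import Algebra.Properties.CommutativeSemigroup +-commutativeSemigroup using (xy∙z≈xz∙y; xy∙z≈x∙zy)
open import Data.Fin using (Fin; zero; suc; toℕ; fromℕ<; inject₁)
open import Data.Fin.Properties using (toℕ-injective; toℕ-fromℕ<; toℕ-inject₁; toℕ<n; any?)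
  renaming (suc-injective to fsuc-injective)
open import Data.List using (List; []; _∷_; _++_; foldr; map)
open import Data.List.Properties using (map-++; map-∘)
open import Data.List.Membership.Propositional using (_∈_)
open import Data.List.Membership.Propositional.Properties using (∈-map⁺; ∈-++⁺ˡ; ∈-++⁺ʳ)
open import Data.List.Relation.Unary.Any using (here; there)
open import Data.Product using (_×_; _,_; ∃-syntax; proj₁; proj₂)
open import Data.Sum using (_⊎_; inj₁; inj₂)
open import Data.Empty using (⊥-elim)
open import Function using (_∘_)
open import Induction.WellFounded using (module All)
open import Relation.Binary.Construct.On as On using ()
open import Relation.Binary.PropositionalEquality
open import Relation.Nullary using (yes; no; ¬_)

sumFin-cong : ∀ n {f g : Fin n → ℕ} → (∀ i → f i ≡ g i) → sumFin n f ≡ sumFin n g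
sumFin-cong zero    f≡g = refl
sumFin-cong (suc n) f≡g = cong₂ _+_ (f≡g zero) (sumFin-cong n (f≡g ∘ suc))

sumFin-mono : ∀ n {f g : Fin n → ℕ} → (∀ i → f i ≤ g i) → sumFin n f ≤ sumFin n g
sumFin-mono zero    f≤g = z≤n
sumFin-mono (suc n) f≤g = +-mono-≤ (f≤g zero) (sumFin-mono n (f≤g ∘ suc))

sumFin-const : ∀ n c → sumFin n (λ _ → c) ≡ n * c
sumFin-const zero    c = refl
sumFin-const (suc n) c = cong (c +_) (sumFin-const n c)

sumFin-raise : ∀ n {f g : Fin n → ℕ} c d → (∀ i → i ≢ c → g i ≡ f i) → g c ≡ f c + d →
               sumFin n g ≡ sumFin n f + d
sumFin-raise (suc n) {f} zero d same raised =
  trans (cong₂ _+_ raised (sumFin-cong n (λ i → same (suc i) λ ())))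
        (xy∙z≈xz∙y (f zero) d _)
sumFin-raise (suc n) {f} (suc c) d same raised =
  trans (cong₂ _+_ (same zero λ ())
                   (sumFin-raise n c d (λ i i≢c → same (suc i) (i≢c ∘ fsuc-injective)) raised))
        (sym (+-assoc (f zero) _ d))

sum-map-++ : ∀ {A : Set} (g : A → ℕ) xs ys → sum (map g (xs ++ ys)) ≡ sum (map g xs) + sum (map g ys)
sum-map-++ g xs ys = trans (cong sum (map-++ g xs ys)) (sum-++ (map g xs) (map g ys))

below : ∀ {p} → Fin p → List (Fin p)
below zero    = []
below (suc a) = inject₁ a ∷ []

above : ∀ {p} → Fin p → List (Fin p)
above {p} a with suc (toℕ a) <? p
... | yes a+1<p = fromℕ< a+1<p ∷ []
... | no  _     = []

adjacent : ∀ {p} → Fin p → List (Fin p)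
adjacent a = below a ++ above a

∈-below : ∀ {p} {a b : Fin p} → suc (toℕ b) ≡ toℕ a → b ∈ below a
∈-below {a = suc a} b+1≡a+1 = here (toℕ-injective (trans (suc-injective b+1≡a+1) (sym (toℕ-inject₁ a))))

∈-above : ∀ {p} {a b : Fin p} → suc (toℕ a) ≡ toℕ b → b ∈ above a
∈-above {p} {a} {b} a+1≡b with suc (toℕ a) <? p
... | yes a+1<p = here (toℕ-injective (trans (sym a+1≡b) (sym (toℕ-fromℕ< a+1<p))))
... | no  a+1≮p = ⊥-elim (a+1≮p (subst (_< p) (sym a+1≡b) (toℕ<n b)))

Consec⇒∈adjacent : ∀ {p} {a b : Fin p} → Consec a b → b ∈ adjacent a
Consec⇒∈adjacent {a = a} (inj₁ a+1≡b) = ∈-++⁺ʳ (below a) (∈-above a+1≡b)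
Consec⇒∈adjacent         (inj₂ b+1≡a) = ∈-++⁺ˡ (∈-below b+1≡a)

Consec-irrefl : ∀ {p} {a : Fin p} → ¬ Consec a a
Consec-irrefl (inj₁ a+1≡a) = 1+n≢n a+1≡a
Consec-irrefl (inj₂ a+1≡a) = 1+n≢n a+1≡a

sum-below-≤ : ∀ {p} (g : Fin p → ℕ) {c} (a : Fin p) → (∀ b → g b ≤ c) → sum (map g (below a)) ≤ c
sum-below-≤ g zero    g≤c = z≤n
sum-below-≤ g (suc a) g≤c = ≤-trans (≤-reflexive (+-identityʳ _)) (g≤c _)

sum-above-≤ : ∀ {p} (g : Fin p → ℕ) {c} (a : Fin p) → (∀ b → g b ≤ c) → sum (map g (above a)) ≤ c
sum-above-≤ {p} g a g≤c with suc (toℕ a) <? p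
... | yes _ = ≤-trans (≤-reflexive (+-identityʳ _)) (g≤c _)
... | no  _ = z≤n

sum-adjacent-≤ : ∀ {p} (g : Fin p → ℕ) {c} (a : Fin p) → (∀ b → g b ≤ c) → sum (map g (adjacent a)) ≤ 2 * c
sum-adjacent-≤ g {c} a g≤c = begin
  sum (map g (below a ++ above a))                ≡⟨ sum-map-++ g (below a) (above a) ⟩
  sum (map g (below a)) + sum (map g (above a))   ≤⟨ +-mono-≤ (sum-below-≤ g a g≤c) (sum-above-≤ g a g≤c) ⟩
  c + c                                           ≡⟨ cong (c +_) (sym (+-identityʳ c)) ⟩
  2 * c                                           ∎
  where open ≤-Reasoning

parabola : ℕ → ℕ → ℕ
parabola m t = suc t * (m ∸ t)

sum-below-parabola : ∀ {p} m (a : Fin p) → sum (map (parabola m ∘ toℕ) (below a)) ≡ toℕ a * (suc m ∸ toℕ a)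
sum-below-parabola m zero    = refl
sum-below-parabola m (suc a) rewrite toℕ-inject₁ a = +-identityʳ _

sum-above-parabola : ∀ {m} (a : Fin m) → sum (map (parabola m ∘ toℕ) (above a)) ≡ (2 + toℕ a) * (m ∸ suc (toℕ a))
sum-above-parabola {m} a with suc (toℕ a) <? m
... | yes a+1<m rewrite toℕ-fromℕ< a+1<m = +-identityʳ _
... | no  a+1≮m rewrite m≤n⇒m∸n≡0 (≮⇒≥ a+1≮m) = sym (*-zeroʳ (2 + toℕ a))

-- The two summands are parabola m (t - 1) and parabola m (t + 1), in a form that vanishes
-- at the missing neighbours t - 1 < 0 and t + 1 = m.
parabola-concave : ∀ {m t} → t < m → t * (suc m ∸ t) + (2 + t) * (m ∸ suc t) + 2 ≡ 2 * parabola m t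
parabola-concave {t = t} t<m with m≤n⇒∃[o]m+o≡n t<m
... | o , refl
  rewrite sym (+-suc t o) | sym (+-suc t (suc o))
        | m+n∸m≡n t o | m+n∸m≡n t (suc o) | m+n∸m≡n t (suc (suc o)) = identity t o
  where
  identity : ∀ t o → t * suc (suc o) + (2 + t) * o + 2 ≡ 2 * (suc t * suc o)
  identity = solve-∀

sum-adjacent-parabola : ∀ {m} (a : Fin m) → sum (map (parabola m ∘ toℕ) (adjacent a)) + 2 ≡ 2 * parabola m (toℕ a)
sum-adjacent-parabola {m} a = begin
  sum (map h (below a ++ above a)) + 2
    ≡⟨ cong (_+ 2) (sum-map-++ h (below a) (above a)) ⟩
  sum (map h (below a)) + sum (map h (above a)) + 2
    ≡⟨ cong (_+ 2) (cong₂ _+_ (sum-below-parabola m a) (sum-above-parabola a)) ⟩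
  toℕ a * (suc m ∸ toℕ a) + (2 + toℕ a) * (m ∸ suc (toℕ a)) + 2
    ≡⟨ parabola-concave (toℕ<n a) ⟩
  2 * parabola m (toℕ a) ∎
  where
  open ≡-Reasoning
  h : Fin m → ℕ
  h = parabola m ∘ toℕ

module _ {m n : ℕ} where

  sumCells : (Cell m n → ℕ) → ℕ
  sumCells f = sumFin m (λ i → sumFin n (λ j → f (i , j)))

  sumCells-raise : ∀ {f g : Cell m n → ℕ} c d → (∀ v → v ≢ c → g v ≡ f v) → g c ≡ f c + d →
                   sumCells g ≡ sumCells f + d
  sumCells-raise (ci , cj) d same raised =
    sumFin-raise m ci d (λ i i≢ci → sumFin-cong n (λ j → same (i , j) (i≢ci ∘ cong proj₁)))
      (sumFin-raise n cj d (λ j j≢cj → same (ci , j) (j≢cj ∘ cong proj₂)) raised)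

  sumCells-1 : sumCells (λ _ → 1) ≡ n * m
  sumCells-1 = begin
    sumFin m (λ _ → sumFin n (λ _ → 1))  ≡⟨ sumFin-const m _ ⟩
    m * sumFin n (λ _ → 1)               ≡⟨ cong (m *_) (trans (sumFin-const n 1) (*-identityʳ n)) ⟩
    m * n                                ≡⟨ *-comm m n ⟩
    n * m                                ∎
    where open ≡-Reasoning

  count≤sumCells : ∀ {f : Cell m n → ℕ} → (∀ v → 1 ≤ f v) → n * m ≤ sumCells f
  count≤sumCells 1≤f =
    ≤-trans (≤-reflexive (sym sumCells-1)) (sumFin-mono m (λ i → sumFin-mono n (λ j → 1≤f (i , j))))

  weighted : (Cell m n → ℕ) → Dist m n → ℕ
  weighted w P = sumCells (λ v → w v * P v)

  size≡weighted-1 : ∀ P → size P ≡ weighted (λ _ → 1) P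
  size≡weighted-1 P = sumFin-cong m (λ i → sumFin-cong n (λ j → sym (*-identityˡ (P (i , j)))))

  weighted-raise : ∀ w {P Q : Dist m n} c d → (∀ v → v ≢ c → Q v ≡ P v) → Q c ≡ P c + d →
                   weighted w Q ≡ weighted w P + w c * d
  weighted-raise w c d same raised =
    sumCells-raise c (w c * d) (λ v v≢c → cong (w v *_) (same v v≢c))
      (trans (cong (w c *_) raised) (*-distribˡ-+ (w c) _ d))

  _[_≔_] : Dist m n → Cell m n → ℕ → Dist m n
  (P [ c ≔ a ]) v with v ≟C c
  ... | yes _ = a
  ... | no  _ = P v

  update-same : ∀ {P c a} → (P [ c ≔ a ]) c ≡ a
  update-same {c = c} with c ≟C c
  ... | yes _   = refl
  ... | no  c≢c = ⊥-elim (c≢c refl)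

  update-other : ∀ {P c a} v → v ≢ c → (P [ c ≔ a ]) v ≡ P v
  update-other {c = c} v v≢c with v ≟C c
  ... | yes v≡c = ⊥-elim (v≢c v≡c)
  ... | no  _   = refl

  addPebble : Cell m n → Dist m n → Dist m n
  addPebble c P = P [ c ≔ suc (P c) ]

  addPebble-≥ : ∀ c P v → P v ≤ addPebble c P v
  addPebble-≥ c P v with v ≟C c
  ... | yes refl = n≤1+n (P v)
  ... | no  _    = ≤-refl

  addPebbles : List (Cell m n) → Dist m n → Dist m n
  addPebbles cs P = foldr addPebble P cs

  addPebbles-≥ : ∀ cs P v → P v ≤ addPebbles cs P v
  addPebbles-≥ []       P v = ≤-refl
  addPebbles-≥ (c ∷ cs) P v = ≤-trans (addPebbles-≥ cs P v) (addPebble-≥ c _ v)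

  addPebbles-∈ : ∀ {cs} P {v} → v ∈ cs → suc (P v) ≤ addPebbles cs P v
  addPebbles-∈ {c ∷ cs} P (here refl) =
    ≤-trans (s≤s (addPebbles-≥ cs P c)) (≤-reflexive (sym (update-same {c = c})))
  addPebbles-∈ {c ∷ cs} P {v} (there v∈cs) =
    ≤-trans (addPebbles-∈ P v∈cs) (addPebble-≥ c _ v)

  weighted-addPebbles : ∀ w cs P → weighted w (addPebbles cs P) ≡ weighted w P + sum (map w cs)
  weighted-addPebbles w []       P = sym (+-identityʳ _)
  weighted-addPebbles w (c ∷ cs) P = begin
    weighted w (addPebble c Q)            ≡⟨ weighted-raise w c 1 update-other Qc+1 ⟩
    weighted w Q + w c * 1                ≡⟨ cong₂ _+_ (weighted-addPebbles w cs P) (*-identityʳ (w c)) ⟩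
    weighted w P + sum (map w cs) + w c   ≡⟨ xy∙z≈x∙zy (weighted w P) _ _ ⟩
    weighted w P + sum (map w (c ∷ cs))   ∎
    where
    open ≡-Reasoning
    Q : Dist m n
    Q = addPebbles cs P
    Qc+1 : addPebble c Q c ≡ Q c + 1
    Qc+1 = trans (update-same {c = c}) (+-comm 1 (Q c))

  neighbours : Cell m n → List (Cell m n)
  neighbours (i , j) = map (_, j) (adjacent i) ++ map (i ,_) (adjacent j)

  Adj⇒∈neighbours : ∀ {x v : Cell m n} → Adj x v → v ∈ neighbours x
  Adj⇒∈neighbours {i , j} (inj₁ (refl , j~j')) = ∈-++⁺ʳ (map (_, j) (adjacent i)) (∈-map⁺ (i ,_) (Consec⇒∈adjacent j~j'))
  Adj⇒∈neighbours         (inj₂ (i~i' , refl)) = ∈-++⁺ˡ (∈-map⁺ _ (Consec⇒∈adjacent i~i'))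

  Adj-irrefl : ∀ {x : Cell m n} → ¬ Adj x x
  Adj-irrefl (inj₁ (_ , j~j)) = Consec-irrefl j~j
  Adj-irrefl (inj₂ (i~i , _)) = Consec-irrefl i~i

  sum-neighbours : ∀ (g : Cell m n → ℕ) i j →
                   sum (map g (neighbours (i , j))) ≡
                   sum (map (λ i' → g (i' , j)) (adjacent i)) + sum (map (λ j' → g (i , j')) (adjacent j))
  sum-neighbours g i j =
    trans (sum-map-++ g (map (_, j) (adjacent i)) (map (i ,_) (adjacent j)))
          (cong₂ (λ r c → sum r + sum c) (sym (map-∘ (adjacent i))) (sym (map-∘ (adjacent j))))

  sum-neighbours-1 : ∀ x → sum (map (λ _ → 1) (neighbours x)) ≤ 4
  sum-neighbours-1 (i , j) = ≤-trans (≤-reflexive (sum-neighbours _ i j))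
    (+-mono-≤ (sum-adjacent-≤ _ i λ _ → ≤-refl) (sum-adjacent-≤ _ j λ _ → ≤-refl))

  height : Cell m n → ℕ
  height (i , _) = parabola m (toℕ i)

  sum-neighbours-height : ∀ x → sum (map height (neighbours x)) + 2 ≤ 4 * height x
  sum-neighbours-height x@(i , j) = begin
    sum (map height (neighbours x)) + 2    ≡⟨ cong (_+ 2) (sum-neighbours height i j) ⟩
    column + row + 2                       ≡⟨ xy∙z≈xz∙y column row 2 ⟩
    column + 2 + row                       ≤⟨ +-mono-≤ (≤-reflexive (sum-adjacent-parabola i)) (sum-adjacent-≤ _ j λ _ → ≤-refl) ⟩
    2 * height x + 2 * height x            ≡⟨ sym (*-distribʳ-+ (height x) 2 2) ⟩
    4 * height x                           ∎
    where
    open ≤-Reasoning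
    column row : ℕ
    column = sum (map (λ i' → height (i' , j)) (adjacent i))
    row    = sum (map (λ j' → height (i , j')) (adjacent j))

  fire : ℕ → Cell m n → Dist m n → Dist m n
  fire t x P = addPebbles (neighbours x) (P [ x ≔ P x ∸ t ])

  weighted-fire : ∀ w t x P → t ≤ P x →
                  weighted w (fire t x P) + w x * t ≡ weighted w P + sum (map w (neighbours x))
  weighted-fire w t x P t≤Px = begin
    weighted w (fire t x P) + w x * t                     ≡⟨ cong (_+ w x * t) (weighted-addPebbles w (neighbours x) P₀) ⟩
    weighted w P₀ + sum (map w (neighbours x)) + w x * t  ≡⟨ xy∙z≈xz∙y (weighted w P₀) _ _ ⟩
    weighted w P₀ + w x * t + sum (map w (neighbours x))  ≡⟨ cong (_+ sum (map w (neighbours x))) (sym P≡P₀+t) ⟩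
    weighted w P + sum (map w (neighbours x))             ∎
    where
    open ≡-Reasoning
    P₀ : Dist m n
    P₀ = P [ x ≔ P x ∸ t ]
    P≡P₀+t : weighted w P ≡ weighted w P₀ + w x * t
    P≡P₀+t = weighted-raise w x t (λ v v≢x → sym (update-other v v≢x))
               (trans (sym (m∸n+n≡m t≤Px)) (cong (_+ t) (sym (update-same {P} {x}))))

  size-fire-≤ : ∀ t x P → 4 ≤ t → t ≤ P x → size (fire t x P) ≤ size P
  size-fire-≤ t x P 4≤t t≤Px = +-cancelʳ-≤ (1 * t) _ _ (begin
    size (fire t x P) + 1 * t                      ≡⟨ cong (_+ 1 * t) (size≡weighted-1 (fire t x P)) ⟩
    weighted one (fire t x P) + 1 * t              ≡⟨ weighted-fire one t x P t≤Px ⟩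
    weighted one P + sum (map one (neighbours x))  ≤⟨ +-monoʳ-≤ _ (≤-trans (sum-neighbours-1 x) 4≤t) ⟩
    weighted one P + t                             ≡⟨ cong₂ _+_ (sym (size≡weighted-1 P)) (sym (*-identityˡ t)) ⟩
    size P + 1 * t                                 ∎)
    where
    open ≤-Reasoning
    one : Cell m n → ℕ
    one _ = 1

  potential : Dist m n → ℕ
  potential = weighted height

  potential-fire-< : ∀ t x P → 4 ≤ t → t ≤ P x → potential (fire t x P) < potential P
  potential-fire-< t x P 4≤t t≤Px = +-cancelʳ-< (height x * t) _ _ (begin-strict
    potential (fire t x P) + height x * t         ≡⟨ weighted-fire height t x P t≤Px ⟩
    potential P + sum (map height (neighbours x)) <⟨ +-monoʳ-< _ (<-≤-trans (m<m+n _ (s≤s z≤n)) (sum-neighbours-height x)) ⟩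
    potential P + 4 * height x                    ≤⟨ +-monoʳ-≤ _ (≤-trans (*-monoˡ-≤ (height x) 4≤t) (≤-reflexive (*-comm t (height x)))) ⟩
    potential P + height x * t                    ∎)
    where open ≤-Reasoning

  module _ {k : ℕ} {u w : Cell m n} where

    moveDist-mono : ∀ {Q R : Dist m n} z → Q z ≤ R z → moveDist k Q u w z ≤ moveDist k R u w z
    moveDist-mono z Qz≤Rz with z ≟C u | z ≟C w
    ... | yes _ | _     = ∸-monoˡ-≤ k Qz≤Rz
    ... | no  _ | yes _ = s≤s Qz≤Rz
    ... | no  _ | no  _ = Qz≤Rz

    moveDist-≥ : ∀ (R : Dist m n) z → z ≢ u → R z ≤ moveDist k R u w z
    moveDist-≥ R z z≢u with z ≟C u | z ≟C w
    ... | yes z≡u | _     = ⊥-elim (z≢u z≡u)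
    ... | no  _   | yes _ = n≤1+n (R z)
    ... | no  _   | no  _ = ≤-refl

    moveDist-suc : ∀ {Q R : Dist m n} z → (z ≡ u → k ≤ Q z) → suc (Q z) ≤ R z →
                   suc (moveDist k Q u w z) ≤ moveDist k R u w z
    moveDist-suc z k≤Qu Qz<Rz with z ≟C u | z ≟C w
    ... | yes z≡u | _     = ≤-trans (≤-reflexive (sym (+-∸-assoc 1 (k≤Qu z≡u)))) (∸-monoˡ-≤ k Qz<Rz)
    ... | no  _   | yes _ = s≤s Qz<Rz
    ... | no  _   | no  _ = Qz<Rz

    moveDist-+ : ∀ {Q R : Dist m n} z c → z ≢ u → Q z ≤ R z + c →
                 moveDist k Q u w z ≤ moveDist k R u w z + c
    moveDist-+ z c z≢u Qz≤Rz+c with z ≟C u | z ≟C w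
    ... | yes z≡u | _     = ⊥-elim (z≢u z≡u)
    ... | no  _   | yes _ = s≤s Qz≤Rz+c
    ... | no  _   | no  _ = Qz≤Rz+c

  _⊑_ : Dist m n → Dist m n → Set
  Q ⊑ R = ∀ v → Q v ≤ R v

  -- R dominates Q as if x had been fired, taking pred k pebbles from x.
  record FiredAt (k : ℕ) (x : Cell m n) (Q R : Dist m n) : Set where
    field
      elsewhere : ∀ v → v ≢ x → Q v ≤ R v
      neighbour : ∀ v → Adj x v → suc (Q v) ≤ R v
      source    : Q x ≤ R x + pred k
      occupied  : 1 ≤ R x

  fire-FiredAt : ∀ t x (P : Dist m n) → suc t ≤ P x → FiredAt (suc t) x P (fire t x P)
  fire-FiredAt t x P t<Px = record
    { elsewhere = λ v v≢x → ≤-trans (≤-reflexive (sym (update-other v v≢x))) (addPebbles-≥ (neighbours x) P₀ v)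
    ; neighbour = λ v x~v → ≤-trans (s≤s (≤-reflexive (sym (update-other v (λ { refl → Adj-irrefl x~v })))))
                                    (addPebbles-∈ P₀ (Adj⇒∈neighbours x~v))
    ; source    = ≤-trans (≤-reflexive (sym (m∸n+n≡m (<⇒≤ t<Px)))) (+-monoˡ-≤ t P₀x≤fire)
    ; occupied  = ≤-trans (m<n⇒0<n∸m t<Px) P₀x≤fire
    }
    where
    P₀ : Dist m n
    P₀ = P [ x ≔ P x ∸ t ]
    P₀x≤fire : P x ∸ t ≤ fire t x P x
    P₀x≤fire = ≤-trans (≤-reflexive (sym (update-same {P} {x}))) (addPebbles-≥ (neighbours x) P₀ x)

  module _ {k : ℕ} {x : Cell m n} {Q R : Dist m n} (fired : FiredAt k x Q R) where
    open FiredAt fired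

    FiredAt-move-source : ∀ {w} → Adj x w → moveDist k Q x w ⊑ R
    FiredAt-move-source {w} x~w v with v ≟C x | v ≟C w
    ... | yes refl | _        = m≤n+o⇒m∸n≤o (Q x) k
                                  (≤-trans source (≤-trans (+-monoʳ-≤ (R x) pred[n]≤n) (≤-reflexive (+-comm (R x) k))))
    ... | no  _    | yes refl = neighbour w x~w
    ... | no  v≢x  | no  _    = elsewhere v v≢x

    FiredAt-move : ∀ {u w} → u ≢ x → k ≤ Q u → FiredAt k x (moveDist k Q u w) (moveDist k R u w)
    FiredAt-move {u} u≢x k≤Qu = record
      { elsewhere = λ v v≢x → moveDist-mono v (elsewhere v v≢x)
      ; neighbour = λ v x~v → moveDist-suc v (λ { refl → k≤Qu }) (neighbour v x~v)
      ; source    = moveDist-+ x (pred k) x≢u source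
      ; occupied  = ≤-trans occupied (moveDist-≥ R x x≢u)
      }
      where
      x≢u : x ≢ u
      x≢u = u≢x ∘ sym

  simulate : ∀ {k x} {P P' Q : Dist m n} → FiredAt k x P P' → Reach k P Q →
             ∃[ R ] (Reach k P' R × (FiredAt k x Q R ⊎ Q ⊑ R))
  simulate fired done = _ , done , inj₁ fired
  simulate {k} {x} fired (step u w play u~w k≤Qu) with simulate fired play
  ... | R , playR , inj₂ Q⊑R =
    moveDist k R u w , step u w playR u~w (≤-trans k≤Qu (Q⊑R u)) , inj₂ (λ v → moveDist-mono v (Q⊑R v))
  ... | R , playR , inj₁ firedQR with u ≟C x
  ...   | yes refl = R , playR , inj₂ (FiredAt-move-source firedQR u~w)
  ...   | no  u≢x  = moveDist k R u w , step u w playR u~w (≤-trans k≤Qu (FiredAt.elsewhere firedQR u u≢x)) ,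
                     inj₁ (FiredAt-move firedQR u≢x k≤Qu)

  solvable-FiredAt : ∀ {k x} {P P' : Dist m n} → FiredAt k x P P' → Solvable k P → Solvable k P'
  solvable-FiredAt {x = x} fired solvable y with solvable y
  ... | Q , play , 1≤Qy with simulate fired play
  ...   | R , playR , inj₂ Q⊑R = R , playR , ≤-trans 1≤Qy (Q⊑R y)
  ...   | R , playR , inj₁ firedQR with y ≟C x
  ...     | yes refl = R , playR , FiredAt.occupied firedQR
  ...     | no  y≢x  = R , playR , ≤-trans 1≤Qy (FiredAt.elsewhere firedQR y y≢x)

  Reach-stable : ∀ {k} {P Q : Dist m n} → (∀ v → P v < k) → Reach k P Q → Q ≡ P
  Reach-stable stable done = refl
  Reach-stable stable (step u _ play _ k≤Qu) with Reach-stable stable play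
  ... | refl = ⊥-elim (<⇒≱ (stable u) k≤Qu)

  solvable-size-≥ : ∀ t → 4 ≤ t → (P : Dist m n) → Solvable (suc t) P → n * m ≤ size P
  solvable-size-≥ t 4≤t = All.wfRec (On.wellFounded potential <-wellFounded) _ _ bound
    where
    bound : ∀ P → (∀ {P'} → potential P' < potential P → Solvable (suc t) P' → n * m ≤ size P') →
            Solvable (suc t) P → n * m ≤ size P
    bound P rec solvable with any? (λ i → any? (λ j → suc t ≤? P (i , j)))
    ... | yes (i , j , t<Px) =
      ≤-trans (rec (potential-fire-< t x P 4≤t (<⇒≤ t<Px)) (solvable-FiredAt (fire-FiredAt t x P t<Px) solvable))
              (size-fire-≤ t x P 4≤t (<⇒≤ t<Px))
      where
      x : Cell m n
      x = (i , j)
    ... | no unstable = count≤sumCells λ y → occupied (solvable y)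
      where
      occupied : ∀ {y} → Reachable (suc t) P y → 1 ≤ P y
      occupied (Q , play , 1≤Qy) rewrite Reach-stable (λ (i , j) → ≰⇒> (λ le → unstable (i , j , le))) play = 1≤Qy

mainTheorem2 : ∀ (k m n : ℕ) → 5 ≤ k → 1 ≤ m → 1 ≤ n → OptPebblingNumberIs k m n (n * m)
mainTheorem2 (suc t) m n (s≤s 4≤t) _ _ =
  (oneEach , (λ y → oneEach , done , ≤-refl) , sumCells-1 {m} {n}) , solvable-size-≥ t 4≤t
  where
  oneEach : Dist m n
  oneEach _ = 1
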